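{- Let $a\geq 4$ and let $k$ be an integer with $2\leq k\leq a/2$. Let $D$ be a strongly connected balanced bipartite digraph of order $2a$ with partite sets $X$ and $Y$ satisfying condition $B_k$. If $D$ is not a (directed) cycle, then $D$ contains a non-Hamiltonian cycle of length at least four, i.e., a directed cycle of length at least $4$ that does not contain all vertices of $D$.
   Context: Digraphs are finite, without loops and without multiple arcs. A digraph is bipartite with partite sets $X,Y$ if every arc has one end in $X$ and the other in $Y$; it is balanced if $|X|=|Y|$. For a vertex $x$, $d(x)=d^+(x)+d^-(x)$. A pair of distinct vertices $\{x,y\}$ is dominating if there is a vertex $z$ with $xz, yz\in A(D)$. A balanced bipartite digraph of order $2a$ satisfies condition $B_k$ if for every dominating pair $\{x,y\}$ either ($d(x)\geq 2a-k$ and $d(y)\geq a+k$) or ($d(x)\geq a+k$ and $d(y)\geq 2a-k$). -}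

module Defs where

open import Data.Nat using (ℕ; zero; suc; _+_; _*_; _∸_; _≤_; _<_)

open import Data.Nat.DivMod using (_%_; m%n<n)
open import Data.Fin using (Fin; toℕ; fromℕ<)
open import Data.Bool using (Bool; true; false; if_then_else_)
open import Data.Product using (Σ; ∃; _×_; _,_)
open import Data.Sum using (_⊎_)
open import Relation.Binary.PropositionalEquality using (_≡_; _≢_)
open import Relation.Nullary using (¬_)
open import Function.Definitions using (Injective)

record Digraph (n : ℕ) : Set where
  field
    arc     : Fin n → Fin n → Bool
    loopless : ∀ v → arc v v ≡ false

open Digraph public

_⟶_within_ : ∀ {n} → Fin n → Fin n → Digraph n → Set
u ⟶ v within D = arc D u v ≡ true

countF : ∀ {n} → (Fin n → Bool) → ℕ
countF {zero}  p = 0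
countF {suc n} p = (if p Fin.zero then 1 else 0) + countF {n} (λ i → p (Fin.suc i))

outdeg indeg deg : ∀ {n} → Digraph n → Fin n → ℕ
outdeg D x = countF (λ y → arc D x y)
indeg  D x = countF (λ y → arc D y x)
deg    D x = outdeg D x + indeg D x

-- Balanced bipartite digraph of order 2a: vertex set Fin (a + a), the partite
-- set X is given by the indicator inX (Y is its complement), |X| = a, and every
-- arc has one end in X and the other in Y.
record BalancedBipartite (a : ℕ) (D : Digraph (a + a)) : Set where
  field
    inX       : Fin (a + a) → Bool
    balanced  : countF inX ≡ a
    bipartite : ∀ u v → u ⟶ v within D → inX u ≢ inX v

data Walk {n} (D : Digraph n) : Fin n → Fin n → Set where
  here : ∀ {u} → Walk D u u
  step : ∀ {u v w} → u ⟶ v within D → Walk D v w → Walk D u w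

StronglyConnected : ∀ {n} → Digraph n → Set
StronglyConnected D = ∀ u v → Walk D u v

cnext : ∀ {m} → Fin m → Fin m
cnext {suc m} i = fromℕ< (m%n<n (suc (toℕ i)) (suc m))

record Cycle {n} (D : Digraph n) (m : ℕ) : Set where
  field
    len≥2  : 2 ≤ m
    vert   : Fin m → Fin n
    injective : Injective _≡_ _≡_ vert
    arcs   : ∀ i → vert i ⟶ vert (cnext i) within D

IsCycle : ∀ {n} → Digraph n → Set
IsCycle {n} D = Σ (Cycle D n) λ C →
  ∀ u v → u ⟶ v within D → ∃ λ i → Cycle.vert C i ≡ u × Cycle.vert C (cnext i) ≡ v

Dominating : ∀ {n} → Digraph n → Fin n → Fin n → Set
Dominating D x y = x ≢ y × ∃ λ z → (x ⟶ z within D) × (y ⟶ z within D)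

ConditionB : (a k : ℕ) → Digraph (a + a) → Set
ConditionB a k D = ∀ x y → Dominating D x y →
  ((2 * a ∸ k ≤ deg D x) × (a + k ≤ deg D y)) ⊎
  ((a + k ≤ deg D x) × (2 * a ∸ k ≤ deg D y))

module Submission where

-- If no two distinct vertices share an out-neighbour, every vertex has at most
-- one in-neighbour; iterating the in-neighbour map from a fixed vertex reaches
-- every vertex, and an orbit argument on Fin n shows that a strongly connected
-- such digraph is a directed cycle.  Otherwise there is a dominating pair
-- {x, y}.  By B_k its degrees sum to at least 3a, and counting neighbourhoods
-- inside the partite set of size a yields at least a 2-paths between x and y.
-- Either they give a 4-cycle x → w → y → u → x directly, or they all run one
-- way and a short chase through further dominating pairs closes a 4-cycle.
-- A 4-cycle misses a vertex of D, as D has 2a ≥ 8 vertices (pigeonhole).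

open import Defs
open import Data.Nat using (ℕ; zero; suc; _+_; _*_; _∸_; _≤_; _<_; z≤n; s≤s; NonZero; >-nonZero⁻¹)
open import Data.Nat.Properties
open import Data.Nat.DivMod using (_%_; _/_; m%n<n; m≡m%n+[m/n]*n; m<n⇒m%n≡m; n%n≡0)
open import Data.Nat.GeneralisedArithmetic using (fold; fold-+)
open import Data.Nat.Tactic.RingSolver using (solve-∀)
open import Data.Fin using (Fin; toℕ; fromℕ<)
open import Data.Fin.Patterns using (0F; 1F; 2F; 3F)
open import Data.Fin.Properties
  using (any?; ¬∀⟶∃¬; injective⇒≤; pigeonhole; toℕ-fromℕ<; toℕ<n; toℕ-injective)
  renaming (_≟_ to _≟F_; suc-injective to Fin-suc-injective)
open import Data.Bool using (Bool; true; false; _∧_; _∨_; not; _xor_)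
open import Data.Bool.Properties using (¬-not; ∧-conicalˡ; ∧-conicalʳ) renaming (_≟_ to _≟B_)
open import Data.Product using (Σ; ∃; ∃₂; _×_; _,_; proj₁; proj₂)
open import Data.Sum using (_⊎_; inj₁; inj₂)
open import Data.Empty using (⊥-elim)
open import Function.Definitions using (Injective)
open import Relation.Binary.Definitions using (tri<; tri≈; tri>)
open import Relation.Binary.PropositionalEquality
open import Relation.Nullary using (¬_; yes; no)
open import Relation.Nullary.Decidable using (¬?; _×-dec_)

countF-mono : ∀ {n} {p q : Fin n → Bool} →
  (∀ i → p i ≡ true → q i ≡ true) → countF p ≤ countF q
countF-mono {zero} p⊆q = z≤n
countF-mono {suc n} {p} {q} p⊆q with p Fin.zero in p₀ | q Fin.zero in q₀
... | true  | true  = s≤s (countF-mono (λ i → p⊆q (Fin.suc i)))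
... | true  | false with () ← trans (sym (p⊆q Fin.zero p₀)) q₀
... | false | true  = m≤n⇒m≤1+n (countF-mono (λ i → p⊆q (Fin.suc i)))
... | false | false = countF-mono (λ i → p⊆q (Fin.suc i))

countF-strict : ∀ {n} {p q : Fin n → Bool} →
  (∀ i → p i ≡ true → q i ≡ true) →
  ∀ j → q j ≡ true → p j ≡ false → countF p < countF q
countF-strict {suc n} {p} {q} p⊆q Fin.zero qj pj rewrite qj | pj =
  s≤s (countF-mono (λ i → p⊆q (Fin.suc i)))
countF-strict {suc n} {p} {q} p⊆q (Fin.suc j) qj pj with p Fin.zero in p₀ | q Fin.zero in q₀
... | true  | true  = s≤s (countF-strict (λ i → p⊆q (Fin.suc i)) j qj pj)
... | true  | false with () ← trans (sym (p⊆q Fin.zero p₀)) q₀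
... | false | true  = m≤n⇒m≤1+n (countF-strict (λ i → p⊆q (Fin.suc i)) j qj pj)
... | false | false = countF-strict (λ i → p⊆q (Fin.suc i)) j qj pj

countF-saturate : ∀ {n} {p q : Fin n → Bool} →
  (∀ i → p i ≡ true → q i ≡ true) → countF q ≤ countF p →
  ∀ i → q i ≡ true → p i ≡ true
countF-saturate {p = p} p⊆q q≤p i qi with p i in pi
... | true  = refl
... | false = ⊥-elim (<⇒≱ (countF-strict p⊆q i qi pi) q≤p)

countF-witness : ∀ {n} (p : Fin n → Bool) → 1 ≤ countF p → ∃ λ i → p i ≡ true
countF-witness {suc n} p pos with p Fin.zero in p₀
... | true  = Fin.zero , p₀
... | false with i , pi ← countF-witness (λ i → p (Fin.suc i)) pos = Fin.suc i , pi

countF-avoid : ∀ {n} (p : Fin n → Bool) (w : Fin n) → 2 ≤ countF p →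
  ∃ λ i → i ≢ w × p i ≡ true
countF-avoid {suc n} p Fin.zero two with p Fin.zero
... | true  with i , pi ← countF-witness (λ i → p (Fin.suc i)) (≤-pred two) = Fin.suc i , (λ ()) , pi
... | false with i , pi ← countF-witness (λ i → p (Fin.suc i)) (≤-trans (s≤s z≤n) two) = Fin.suc i , (λ ()) , pi
countF-avoid {suc n} p (Fin.suc w) two with p Fin.zero in p₀
... | true  = Fin.zero , (λ ()) , p₀
... | false with i , i≢w , pi ← countF-avoid (λ i → p (Fin.suc i)) w two =
  Fin.suc i , (λ e → i≢w (Fin-suc-injective e)) , pi

countF-∨-∧ : ∀ {n} (p q : Fin n → Bool) →
  countF p + countF q ≡ countF (λ i → p i ∨ q i) + countF (λ i → p i ∧ q i)
countF-∨-∧ {zero} p q = refl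
countF-∨-∧ {suc n} p q with p Fin.zero | q Fin.zero
... | true  | true  = cong suc (trans (+-suc _ _)
                        (trans (cong suc (countF-∨-∧ (λ i → p (Fin.suc i)) (λ i → q (Fin.suc i))))
                               (sym (+-suc _ _))))
... | true  | false = cong suc (countF-∨-∧ (λ i → p (Fin.suc i)) (λ i → q (Fin.suc i)))
... | false | true  = trans (+-suc _ _) (cong suc (countF-∨-∧ (λ i → p (Fin.suc i)) (λ i → q (Fin.suc i))))
... | false | false = countF-∨-∧ (λ i → p (Fin.suc i)) (λ i → q (Fin.suc i))

countF-not : ∀ {n} (p : Fin n → Bool) → countF p + countF (λ i → not (p i)) ≡ n
countF-not {zero} p = refl
countF-not {suc n} p with p Fin.zero
... | true  = cong suc (countF-not (λ i → p (Fin.suc i)))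
... | false = trans (+-suc _ _) (cong suc (countF-not (λ i → p (Fin.suc i))))

countF-witness-pair : ∀ {n} (p q : Fin n → Bool) → 2 ≤ countF p → 1 ≤ countF q →
  ∃₂ λ u w → u ≢ w × p u ≡ true × q w ≡ true
countF-witness-pair p q p≥2 q≥1 with w , qw ← countF-witness q q≥1
                                 with u , u≢w , pu ← countF-avoid p w p≥2 = u , w , u≢w , pu , qw

countF-distinct-witnesses : ∀ {n} (p q : Fin n → Bool) →
  1 ≤ countF p → 1 ≤ countF q → 3 ≤ countF p + countF q →
  ∃₂ λ u w → u ≢ w × p u ≡ true × q w ≡ true
countF-distinct-witnesses p q p≥1 q≥1 total with 2 ≤? countF p
... | yes p≥2 = countF-witness-pair p q p≥2 q≥1
... | no p≱2 =
  let w , u , w≢u , qw , pu = countF-witness-pair q p q≥2 p≥1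
  in  u , w , (λ e → w≢u (sym e)) , pu , qw
  where
  q≥2 : 2 ≤ countF q
  q≥2 = +-cancelˡ-≤ 1 2 (countF q) (≤-trans total (+-monoˡ-≤ (countF q) (≤-pred (≰⇒> p≱2))))

-- Pigeonhole: a map into a strictly larger finite set misses some point,
-- because a right inverse of a surjection would be injective.
missedPoint : ∀ {m n} → m < n → (f : Fin m → Fin n) → ∃ λ v → ∀ i → f i ≢ v
missedPoint {m} {n} m<n f =
  let v , unhit = ¬∀⟶∃¬ n (λ v → ∃ λ i → f i ≡ v) (λ v → any? (λ i → f i ≟F v)) notOnto
  in  v , λ i e → unhit (i , e)
  where
  notOnto : ¬ (∀ v → ∃ λ i → f i ≡ v)
  notOnto onto = <⇒≱ m<n (injective⇒≤ sectionInjective)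
    where
    sectionInjective : Injective _≡_ _≡_ (λ v → proj₁ (onto v))
    sectionInjective {v} {w} e = trans (sym (proj₂ (onto v))) (trans (cong f e) (proj₂ (onto w)))

-- If every point lies on the forward
-- orbit of v₀ and v₀ itself has a preimage, then the orbit is one cycle of
-- length exactly n: fⁿ fixes v₀, no n consecutive iterates repeat, and f is
-- injective.  The iterates are fⁱ v₀ = fold v₀ f i.
module Orbit {n : ℕ} {{_ : NonZero n}} (f : Fin n → Fin n) (v₀ : Fin n)
  (reach : ∀ t → ∃ λ j → fold v₀ f j ≡ t) (hit : ∃ λ w → f w ≡ v₀) where

  orbit : ℕ → Fin n
  orbit = fold v₀ f

  orbit-shift : ∀ {d} → orbit d ≡ v₀ → ∀ j → orbit (j + d) ≡ orbit j
  orbit-shift {d} back j = trans (fold-+ v₀ f j) (cong (λ z → fold z f j) back)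

  orbit-multiple : ∀ {d} → orbit d ≡ v₀ → ∀ i → orbit (i * d) ≡ v₀
  orbit-multiple back zero    = refl
  orbit-multiple {d} back (suc i) = begin
    orbit (d + i * d) ≡⟨ cong orbit (+-comm d (i * d)) ⟩
    orbit (i * d + d) ≡⟨ orbit-shift back (i * d) ⟩
    orbit (i * d)     ≡⟨ orbit-multiple back i ⟩
    v₀                ∎
    where open ≡-Reasoning

  orbit-mod : ∀ d .{{_ : NonZero d}} → orbit d ≡ v₀ → ∀ j → orbit j ≡ orbit (j % d)
  orbit-mod d back j = begin
    orbit j                       ≡⟨ cong orbit (m≡m%n+[m/n]*n j d) ⟩
    orbit (j % d + (j / d) * d)   ≡⟨ orbit-shift (orbit-multiple back (j / d)) (j % d) ⟩
    orbit (j % d)                 ∎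
    where open ≡-Reasoning

  -- Some positive number of steps returns to v₀: the preimage of v₀ is on the orbit.
  returnTime : ∃ λ e → orbit (suc e) ≡ v₀
  returnTime = let w , fw≡v₀ = hit ; j , orbit-j = reach w in j , trans (cong f orbit-j) fw≡v₀

  -- A positive return time is at least n: the first d iterates already cover Fin n.
  returnTime≥n : ∀ {d} → 0 < d → orbit d ≡ v₀ → n ≤ d
  returnTime≥n {suc d} _ back = injective⇒≤ {f = index} indexInjective
    where
    index : Fin n → Fin (suc d)
    index t = fromℕ< (m%n<n (proj₁ (reach t)) (suc d))
    orbit-index : ∀ t → orbit (toℕ (index t)) ≡ t
    orbit-index t = begin
      orbit (toℕ (index t))            ≡⟨ cong orbit (toℕ-fromℕ< (m%n<n (proj₁ (reach t)) (suc d))) ⟩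
      orbit (proj₁ (reach t) % suc d)  ≡⟨ sym (orbit-mod (suc d) back (proj₁ (reach t))) ⟩
      orbit (proj₁ (reach t))          ≡⟨ proj₂ (reach t) ⟩
      t                                ∎
      where open ≡-Reasoning
    indexInjective : Injective _≡_ _≡_ index
    indexInjective {t} {u} e =
      trans (sym (orbit-index t)) (trans (cong (λ i → orbit (toℕ i)) e) (orbit-index u))

  -- A repetition fⁱ v₀ = fʲ v₀ (i < j) makes j - i a return time: walk on
  -- from both sides to the multiple i·(e+1) of a known return time e+1.
  orbit-cancel : ∀ {i j} → i < j → orbit i ≡ orbit j → orbit (j ∸ i) ≡ v₀
  orbit-cancel {i} {j} i<j same = begin
    orbit (j ∸ i)           ≡⟨ sym (orbit-shift backM (j ∸ i)) ⟩
    orbit ((j ∸ i) + M)     ≡⟨ cong orbit reorder ⟩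
    orbit ((M ∸ i) + j)     ≡⟨ fold-+ v₀ f (M ∸ i) ⟩
    fold (orbit j) f (M ∸ i) ≡⟨ cong (λ z → fold z f (M ∸ i)) (sym same) ⟩
    fold (orbit i) f (M ∸ i) ≡⟨ sym (fold-+ v₀ f (M ∸ i)) ⟩
    orbit ((M ∸ i) + i)     ≡⟨ cong orbit (m∸n+n≡m i≤M) ⟩
    orbit M                 ≡⟨ backM ⟩
    v₀                      ∎
    where
    open ≡-Reasoning
    e : ℕ
    e = proj₁ returnTime
    M : ℕ
    M = i * suc e
    backM : orbit M ≡ v₀
    backM = orbit-multiple (proj₂ returnTime) i
    i≤M : i ≤ M
    i≤M = m≤m*n i (suc e)
    reorder : (j ∸ i) + M ≡ (M ∸ i) + j
    reorder = begin
      (j ∸ i) + M   ≡⟨ +-comm (j ∸ i) M ⟩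
      M + (j ∸ i)   ≡⟨ sym (+-∸-assoc M (<⇒≤ i<j)) ⟩
      (M + j) ∸ i   ≡⟨ +-∸-comm j i≤M ⟩
      (M ∸ i) + j   ∎

  orbit-distinct : ∀ {i j} → i < j → j ∸ i < n → orbit i ≢ orbit j
  orbit-distinct i<j close same =
    <⇒≱ close (returnTime≥n (m<n⇒0<n∸m i<j) (orbit-cancel i<j same))

  -- The orbit closes up after exactly n steps: among n + 1 iterates two
  -- coincide, and their distance is a positive return time of at most n.
  orbit-period : orbit n ≡ v₀
  orbit-period with i , j , i<j , same ← pigeonhole (n<1+n n) (λ (i : Fin (suc n)) → orbit (toℕ i)) =
    subst (λ d → orbit d ≡ v₀) gap≡n (orbit-cancel i<j same)
    where
    gap≡n : toℕ j ∸ toℕ i ≡ n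
    gap≡n = ≤-antisym (≤-trans (m∸n≤m (toℕ j) (toℕ i)) (≤-pred (toℕ<n j)))
                      (returnTime≥n (m<n⇒0<n∸m i<j) (orbit-cancel i<j same))

  reach-window : ∀ t → ∃ λ s → 0 < s × s ≤ n × orbit s ≡ t
  reach-window t with j , orbit-j ← reach t with j % n in j%n
  ... | zero  = n , >-nonZero⁻¹ n , ≤-refl , (begin
    orbit n        ≡⟨ orbit-period ⟩
    orbit 0        ≡⟨ cong orbit (sym j%n) ⟩
    orbit (j % n)  ≡⟨ sym (orbit-mod n orbit-period j) ⟩
    orbit j        ≡⟨ orbit-j ⟩
    t              ∎)
    where open ≡-Reasoning
  ... | suc s = suc s , s≤s z≤n , subst (_≤ n) j%n (<⇒≤ (m%n<n j n)) , (begin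
    orbit (suc s)  ≡⟨ cong orbit (sym j%n) ⟩
    orbit (j % n)  ≡⟨ sym (orbit-mod n orbit-period j) ⟩
    orbit j        ≡⟨ orbit-j ⟩
    t              ∎)
    where open ≡-Reasoning

  window-gap : ∀ {b i j} → b ≤ i → j < b + n → j ∸ i < n
  window-gap {b} {i} {j} b≤i j<b+n = ≤-<-trans (∸-monoʳ-≤ j b≤i) (m<n+o⇒m∸n<o j b j<b+n)

  orbit-injective-on : ∀ b {i j} → b ≤ i → b ≤ j → i < b + n → j < b + n →
    orbit i ≡ orbit j → i ≡ j
  orbit-injective-on b {i} {j} b≤i b≤j i<b+n j<b+n same with <-cmp i j
  ... | tri≈ _ i≡j _ = i≡j
  ... | tri< i<j _ _ = ⊥-elim (orbit-distinct i<j (window-gap b≤i j<b+n) same)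
  ... | tri> _ _ j<i = ⊥-elim (orbit-distinct j<i (window-gap b≤j i<b+n) (sym same))

  -- f is injective: f v = f w lifts the window indices of v and w by one.
  f-injective : ∀ {v w} → f v ≡ f w → v ≡ w
  f-injective {v} {w} same with s , 0<s , s≤n , orbit-s ← reach-window v
                              with s' , 0<s' , s'≤n , orbit-s' ← reach-window w = begin
    v            ≡⟨ sym orbit-s ⟩
    orbit s      ≡⟨ cong orbit (suc-injective (orbit-injective-on 2
                      (s≤s 0<s) (s≤s 0<s') (s≤s (s≤s s≤n)) (s≤s (s≤s s'≤n)) lifted)) ⟩
    orbit s'     ≡⟨ orbit-s' ⟩
    w            ∎
    where
    open ≡-Reasoning
    lifted : orbit (suc s) ≡ orbit (suc s')
    lifted = trans (cong f orbit-s) (trans same (cong f (sym orbit-s')))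

cnext-step : ∀ {m} (i : Fin (suc m)) → suc (toℕ i) < suc m → toℕ (cnext i) ≡ suc (toℕ i)
cnext-step {m} i notLast = trans (toℕ-fromℕ< (m%n<n (suc (toℕ i)) (suc m))) (m<n⇒m%n≡m notLast)

cnext-wrap : ∀ {m} (i : Fin (suc m)) → suc (toℕ i) ≡ suc m → toℕ (cnext i) ≡ 0
cnext-wrap {m} i last = trans (toℕ-fromℕ< (m%n<n (suc (toℕ i)) (suc m)))
                              (trans (cong (_% suc m) last) (n%n≡0 (suc m)))

anotherPoint : ∀ {n} → 2 ≤ n → (v : Fin n) → ∃ λ u → u ≢ v
anotherPoint (s≤s (s≤s z≤n)) Fin.zero    = Fin.suc Fin.zero , λ ()
anotherPoint (s≤s (s≤s z≤n)) (Fin.suc _) = Fin.zero , λ ()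

firstArc : ∀ {n} {D : Digraph n} {u v} → Walk D u v → u ≢ v → ∃ λ w → u ⟶ w within D
firstArc here             u≢v = ⊥-elim (u≢v refl)
firstArc (step {v = w} a _) _ = w , a

lastArc : ∀ {n} {D : Digraph n} {u v} → Walk D u v → u ≢ v → ∃ λ w → w ⟶ v within D
lastArc here u≢v = ⊥-elim (u≢v refl)
lastArc {u = u} {v} (step {v = w} a rest) _ with w ≟F v
... | yes refl = u , a
... | no  w≢v  = lastArc rest w≢v

-- The in-neighbour map pred has every vertex on
-- the orbit of v₀ (follow a walk to v₀ backwards), so by the orbit lemma it
-- runs once around all n vertices; read backwards, this orbit is the cycle.
module FunctionalDigraph {m : ℕ} (D : Digraph (suc m)) (twoVertices : 2 ≤ suc m)
  (strong : StronglyConnected D)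
  (uniqueIn : ∀ {u u' v} → u ⟶ v within D → u' ⟶ v within D → u ≡ u') where

  n : ℕ
  n = suc m

  pred : Fin n → Fin n
  pred v = let u , u≢v = anotherPoint twoVertices v in proj₁ (lastArc (strong u v) u≢v)

  pred-arc : ∀ v → pred v ⟶ v within D
  pred-arc v = let u , u≢v = anotherPoint twoVertices v in proj₂ (lastArc (strong u v) u≢v)

  pred-unique : ∀ {u v} → u ⟶ v within D → u ≡ pred v
  pred-unique a = uniqueIn a (pred-arc _)

  v₀ : Fin n
  v₀ = Fin.zero

  walk-orbit : ∀ {t} → Walk D t v₀ → ∃ λ j → fold v₀ pred j ≡ t
  walk-orbit here = 0 , refl
  walk-orbit (step a rest) = let j , orbit-j = walk-orbit rest
                             in suc j , sym (trans (pred-unique a) (cong pred (sym orbit-j)))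

  v₀-hit : ∃ λ w → pred w ≡ v₀
  v₀-hit = let u , u≢v₀ = anotherPoint twoVertices v₀
               w , a = firstArc (strong v₀ u) (λ e → u≢v₀ (sym e))
           in w , sym (pred-unique a)

  open Orbit pred v₀ (λ t → walk-orbit (strong t v₀)) v₀-hit

  -- The cycle visits v₀ = predⁿ v₀ first and then pred^(n-1) v₀, …, pred v₀.
  vert : Fin n → Fin n
  vert i = orbit (n ∸ toℕ i)

  -- Consecutive cycle vertices are joined by the predecessor map; at the
  -- wrap-around this uses predⁿ v₀ = v₀.
  vert-arc : ∀ i → pred (vert (cnext i)) ≡ vert i
  vert-arc i with m≤n⇒m<n∨m≡n (toℕ<n i)
  ... | inj₁ notLast = begin
    pred (orbit (n ∸ toℕ (cnext i)))   ≡⟨ cong (λ c → pred (orbit (n ∸ c))) (cnext-step i notLast) ⟩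
    orbit (suc (n ∸ suc (toℕ i)))      ≡⟨ cong orbit (sym (+-∸-assoc 1 (toℕ<n i))) ⟩
    orbit (n ∸ toℕ i)                  ∎
    where open ≡-Reasoning
  ... | inj₂ last = begin
    pred (orbit (n ∸ toℕ (cnext i)))   ≡⟨ cong (λ c → pred (orbit (n ∸ c))) (cnext-wrap i last) ⟩
    pred (orbit n)                     ≡⟨ cong pred orbit-period ⟩
    orbit 1                            ≡⟨ cong orbit (sym n∸i≡1) ⟩
    orbit (n ∸ toℕ i)                  ∎
    where
    open ≡-Reasoning
    n∸i≡1 : n ∸ toℕ i ≡ 1
    n∸i≡1 = trans (cong (_∸ toℕ i) (sym last)) (m+n∸n≡m 1 (toℕ i))

  -- The indices n - i lie in the window [1, n], where iterates are distinct.
  vert-injective : Injective _≡_ _≡_ vert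
  vert-injective {i} {j} same = toℕ-injective (∸-cancelˡ-≡ (<⇒≤ (toℕ<n i)) (<⇒≤ (toℕ<n j))
    (orbit-injective-on 1 (m<n⇒0<n∸m (toℕ<n i)) (m<n⇒0<n∸m (toℕ<n j))
                          (s≤s (m∸n≤m n (toℕ i))) (s≤s (m∸n≤m n (toℕ j))) same))

  vert-surjective : ∀ v → ∃ λ i → vert i ≡ v
  vert-surjective v with s , 0<s , s≤n , orbit-s ← reach-window v =
    fromℕ< n∸s<n , (begin
      orbit (n ∸ toℕ (fromℕ< n∸s<n)) ≡⟨ cong (λ c → orbit (n ∸ c)) (toℕ-fromℕ< n∸s<n) ⟩
      orbit (n ∸ (n ∸ s))           ≡⟨ cong orbit (m∸[m∸n]≡n s≤n) ⟩
      orbit s                       ≡⟨ orbit-s ⟩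
      v                             ∎)
    where
    open ≡-Reasoning
    n∸s<n : n ∸ s < n
    n∸s<n = ∸-monoʳ-< 0<s s≤n

  cycle : Cycle D n
  cycle = record
    { len≥2     = twoVertices
    ; vert      = vert
    ; injective = vert-injective
    ; arcs      = λ i → subst (λ u → u ⟶ vert (cnext i) within D) (vert-arc i) (pred-arc (vert (cnext i)))
    }

  -- Every arc u → v is a cycle arc: u = vert i forces v = vert (cnext i),
  -- since both have predecessor u and pred is injective.
  isCycle : IsCycle D
  isCycle = cycle , λ u v a →
    let i , vert-i = vert-surjective u
    in  i , vert-i , f-injective (trans (vert-arc i) (trans vert-i (pred-unique a)))

dominatingPairOrUniqueIn : ∀ {n} (D : Digraph n) →
  (∃₂ λ x y → Dominating D x y) ⊎
  (∀ {u u' v} → u ⟶ v within D → u' ⟶ v within D → u ≡ u')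
dominatingPairOrUniqueIn D
  with any? (λ z → any? (λ x → any? (λ y →
         ¬? (x ≟F y) ×-dec (arc D x z ≟B true) ×-dec (arc D y z ≟B true))))
... | yes (z , x , y , x≢y , x→z , y→z) = inj₁ (x , y , x≢y , z , x→z , y→z)
... | no noPair = inj₂ unique
  where
  unique : ∀ {u u' v} → u ⟶ v within D → u' ⟶ v within D → u ≡ u'
  unique {u} {u'} {v} u→v u'→v with u ≟F u'
  ... | yes u≡u' = u≡u'
  ... | no  u≢u' = ⊥-elim (noPair (v , u , u' , u≢u' , u→v , u'→v))

arc≢ : ∀ {n} (D : Digraph n) {u v} → u ⟶ v within D → u ≢ v
arc≢ D {u} u→v refl with () ← trans (sym u→v) (loopless D u)

-- A closed walk c₀ → c₁ → c₂ → c₃ → c₀ whose opposite vertices differ is a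
-- 4-cycle (consecutive vertices differ automatically).
fourCycle : ∀ {n} (D : Digraph n) {c₀ c₁ c₂ c₃ : Fin n} →
  c₀ ⟶ c₁ within D → c₁ ⟶ c₂ within D → c₂ ⟶ c₃ within D → c₃ ⟶ c₀ within D →
  c₀ ≢ c₂ → c₁ ≢ c₃ → Cycle D 4
fourCycle D {c₀} {c₁} {c₂} {c₃} a₀₁ a₁₂ a₂₃ a₃₀ c₀≢c₂ c₁≢c₃ = record
  { len≥2 = s≤s (s≤s z≤n) ; vert = c ; injective = λ {i} {j} → injective i j ; arcs = arcs }
  where
  c : Fin 4 → Fin _
  c 0F = c₀
  c 1F = c₁
  c 2F = c₂
  c 3F = c₃

  arcs : ∀ i → c i ⟶ c (cnext i) within D
  arcs 0F = a₀₁
  arcs 1F = a₁₂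
  arcs 2F = a₂₃
  arcs 3F = a₃₀

  injective : ∀ i j → c i ≡ c j → i ≡ j
  injective 0F 0F _ = refl
  injective 1F 1F _ = refl
  injective 2F 2F _ = refl
  injective 3F 3F _ = refl
  injective 0F 1F e = ⊥-elim (arc≢ D a₀₁ e)
  injective 1F 2F e = ⊥-elim (arc≢ D a₁₂ e)
  injective 2F 3F e = ⊥-elim (arc≢ D a₂₃ e)
  injective 3F 0F e = ⊥-elim (arc≢ D a₃₀ e)
  injective 1F 0F e = ⊥-elim (arc≢ D a₀₁ (sym e))
  injective 2F 1F e = ⊥-elim (arc≢ D a₁₂ (sym e))
  injective 3F 2F e = ⊥-elim (arc≢ D a₂₃ (sym e))
  injective 0F 3F e = ⊥-elim (arc≢ D a₃₀ (sym e))
  injective 0F 2F e = ⊥-elim (c₀≢c₂ e)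
  injective 2F 0F e = ⊥-elim (c₀≢c₂ (sym e))
  injective 1F 3F e = ⊥-elim (c₁≢c₃ e)
  injective 3F 1F e = ⊥-elim (c₁≢c₃ (sym e))

both-differ : ∀ {b c d : Bool} → b ≢ d → c ≢ d → b ≡ c
both-differ b≢d c≢d = trans (¬-not b≢d) (sym (¬-not c≢d))

xor-differ : ∀ {b c : Bool} → b ≢ c → b xor c ≡ true
xor-differ {true}  {true}  b≢c = ⊥-elim (b≢c refl)
xor-differ {true}  {false} _   = refl
xor-differ {false} {true}  _   = refl
xor-differ {false} {false} b≢c = ⊥-elim (b≢c refl)

Bk-bounds-ordered : ∀ a k → 2 * k ≤ a → a + k ≤ 2 * a ∸ k
Bk-bounds-ordered a k 2k≤a = m+n≤o⇒m≤o∸n (a + k) (begin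
  (a + k) + k  ≡⟨ +-assoc a k k ⟩
  a + (k + k)  ≡⟨ cong (λ t → a + (k + t)) (sym (+-identityʳ k)) ⟩
  a + 2 * k    ≤⟨ +-monoʳ-≤ a 2k≤a ⟩
  a + a        ≡⟨ cong (a +_) (sym (+-identityʳ a)) ⟩
  2 * a        ∎)
  where open ≤-Reasoning

Bk-bounds-sum : ∀ a k → 2 * k ≤ a → (2 * a ∸ k) + (a + k) ≡ (a + a) + a
Bk-bounds-sum a k 2k≤a = begin
  (2 * a ∸ k) + (a + k)  ≡⟨ cong ((2 * a ∸ k) +_) (+-comm a k) ⟩
  (2 * a ∸ k) + (k + a)  ≡⟨ sym (+-assoc (2 * a ∸ k) k a) ⟩
  (2 * a ∸ k) + k + a    ≡⟨ cong (_+ a) (m∸n+n≡m k≤2a) ⟩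
  2 * a + a              ≡⟨ cong (λ t → (a + t) + a) (+-identityʳ a) ⟩
  (a + a) + a            ∎
  where
  open ≡-Reasoning
  k≤2a : k ≤ 2 * a
  k≤2a = ≤-trans (m≤m+n k (k + 0)) (≤-trans 2k≤a (m≤m+n a (a + 0)))

module BipartiteBk (a k : ℕ) (k≥2 : 2 ≤ k) (2k≤a : 2 * k ≤ a)
  (D : Digraph (a + a)) (bb : BalancedBipartite a D) (cond : ConditionB a k D) where

  open BalancedBipartite bb

  a≥4 : 4 ≤ a
  a≥4 = ≤-trans (*-monoʳ-≤ 2 k≥2) 2k≤a

  -- The partite set not containing v.
  opposite : Fin (a + a) → Fin (a + a) → Bool
  opposite v u = inX v xor inX u

  opposite-size : ∀ v → countF (opposite v) ≡ a
  opposite-size v with inX v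
  ... | false = balanced
  ... | true  = +-cancelˡ-≡ a _ _ (begin
    a + countF (λ u → not (inX u))       ≡⟨ cong (_+ countF (λ u → not (inX u))) (sym balanced) ⟩
    countF inX + countF (λ u → not (inX u)) ≡⟨ countF-not inX ⟩
    a + a                                ∎)
    where open ≡-Reasoning

  opposite-out : ∀ {v u} → v ⟶ u within D → opposite v u ≡ true
  opposite-out {v} {u} v→u = xor-differ (bipartite v u v→u)

  opposite-in : ∀ {v u} → u ⟶ v within D → opposite v u ≡ true
  opposite-in {v} {u} u→v = xor-differ (λ e → bipartite u v u→v (sym e))

  dominating-same-side : ∀ {x y} → Dominating D x y → inX x ≡ inX y
  dominating-same-side (_ , z , x→z , y→z) = both-differ (bipartite _ z x→z) (bipartite _ z y→z)

  path-same-side : ∀ {u p w} → u ⟶ p within D → p ⟶ w within D → inX u ≡ inX w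
  path-same-side {u} {p} {w} u→p p→w =
    both-differ (bipartite u p u→p) (λ e → bipartite p w p→w (sym e))

  -- Out-neighbours lie in the opposite partite set.
  outdeg≤a : ∀ v → outdeg D v ≤ a
  outdeg≤a v = ≤-trans (countF-mono {p = arc D v} (λ u → opposite-out)) (≤-reflexive (opposite-size v))

  dominating-sym : ∀ {x y} → Dominating D x y → Dominating D y x
  dominating-sym (x≢y , z , x→z , y→z) = (λ e → x≢y (sym e)) , z , y→z , x→z

  dominating-degree : ∀ {x y} → Dominating D x y → a + 2 ≤ deg D x
  dominating-degree {x} {y} d with cond x y d
  ... | inj₁ (x-large , _) = ≤-trans (+-monoʳ-≤ a k≥2) (≤-trans (Bk-bounds-ordered a k 2k≤a) x-large)
  ... | inj₂ (x-small , _) = ≤-trans (+-monoʳ-≤ a k≥2) x-small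

  dominating-degree-sum : ∀ {x y} → Dominating D x y → (a + a) + a ≤ deg D x + deg D y
  dominating-degree-sum {x} {y} d with cond x y d
  ... | inj₁ (x-large , y-small) =
    subst (_≤ deg D x + deg D y) (Bk-bounds-sum a k 2k≤a) (+-mono-≤ x-large y-small)
  ... | inj₂ (x-small , y-large) =
    subst (_≤ deg D x + deg D y) (trans (+-comm (a + k) _) (Bk-bounds-sum a k 2k≤a))
          (+-mono-≤ x-small y-large)

  -- As out-degrees are at most a, a dominating vertex has two in-neighbours.
  dominating-indeg : ∀ {x y} → Dominating D x y → 2 ≤ indeg D x
  dominating-indeg {x} d =
    +-cancelˡ-≤ a 2 (indeg D x) (≤-trans (dominating-degree d) (+-monoˡ-≤ (indeg D x) (outdeg≤a x)))

  via : Fin (a + a) → Fin (a + a) → Fin (a + a) → Bool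
  via s t v = arc D s v ∧ arc D v t

  -- If s and t share a side, out-neighbours of s and in-neighbours of t all
  -- lie in the opposite partite set, which has a vertices.
  neighbourhood-bound : ∀ {s t} → inX s ≡ inX t → countF (λ v → arc D s v ∨ arc D v t) ≤ a
  neighbourhood-bound {s} {t} same =
    ≤-trans (countF-mono {q = opposite s} inside) (≤-reflexive (opposite-size s))
    where
    inside : ∀ v → (arc D s v ∨ arc D v t) ≡ true → opposite s v ≡ true
    inside v s→v∨v→t with arc D s v in s→v
    ... | true  = opposite-out s→v
    ... | false = subst (λ b → b xor inX v ≡ true) (sym same) (opposite-in s→v∨v→t)

  -- Counting: out(s) + in(t) = |out(s) ∪ in(t)| + |via s t| ≤ a + |via s t|.
  via-bound : ∀ {s t} → inX s ≡ inX t → outdeg D s + indeg D t ≤ a + countF (via s t)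
  via-bound {s} {t} same = begin
    outdeg D s + indeg D t                                       ≡⟨ countF-∨-∧ (arc D s) (λ v → arc D v t) ⟩
    countF (λ v → arc D s v ∨ arc D v t) + countF (via s t)      ≤⟨ +-monoˡ-≤ _ (neighbourhood-bound same) ⟩
    a + countF (via s t)                                         ∎
    where open ≤-Reasoning

  -- For a dominating pair the 2-paths between x and y, in both directions,
  -- number at least a: the degree sum 3a exceeds the 2a available for union sets.
  via-count : ∀ {x y} → Dominating D x y → a ≤ countF (via y x) + countF (via x y)
  via-count {x} {y} d = +-cancelˡ-≤ (a + a) a _ (begin
    (a + a) + a                                           ≤⟨ dominating-degree-sum d ⟩
    deg D x + deg D y                                     ≡⟨ regroup (outdeg D x) (indeg D x) (outdeg D y) (indeg D y) ⟩
    (outdeg D y + indeg D x) + (outdeg D x + indeg D y)   ≤⟨ +-mono-≤ (via-bound (sym same)) (via-bound same) ⟩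
    (a + countF (via y x)) + (a + countF (via x y))       ≡⟨ regroup′ a (countF (via y x)) (countF (via x y)) ⟩
    (a + a) + (countF (via y x) + countF (via x y))       ∎)
    where
    open ≤-Reasoning
    same : inX x ≡ inX y
    same = dominating-same-side d
    regroup : ∀ ox ix oy iy → (ox + ix) + (oy + iy) ≡ (oy + ix) + (ox + iy)
    regroup = solve-∀
    regroup′ : ∀ a m n → (a + m) + (a + n) ≡ (a + a) + (m + n)
    regroup′ = solve-∀

  via-saturated : ∀ {s t} → a ≤ countF (via s t) → ∀ v → opposite t v ≡ true → via s t v ≡ true
  via-saturated {s} {t} many =
    countF-saturate (λ v s→v→t → opposite-in (∧-conicalʳ _ _ s→v→t))
                    (≤-trans (≤-reflexive (opposite-size t)) many)

  -- Take an
  -- in-neighbour w of y; w dominates x with any other opposite vertex, so it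
  -- has an in-neighbour p ≠ y; as y → w too, p and y dominate w, so p has an
  -- in-neighbour u ≠ w, opposite x like w.  This gives y → u → p → w → y.
  saturated-fourCycle : ∀ {x y} → Dominating D x y →
    (∀ v → opposite x v ≡ true → via y x v ≡ true) → Cycle D 4
  saturated-fourCycle {x} {y} d full =
    let w , w→y = countF-witness (λ v → arc D v y)
                    (≤-trans (s≤s z≤n) (dominating-indeg (dominating-sym d)))
        opp-w : opposite x w ≡ true
        opp-w = subst (λ b → b xor inX w ≡ true) (sym (dominating-same-side d)) (opposite-in w→y)
        w' , w'≢w , opp-w' = countF-avoid (opposite x) w
                               (subst (2 ≤_) (sym (opposite-size x)) (≤-trans (s≤s (s≤s z≤n)) a≥4))
        p , p≢y , p→w = countF-avoid (λ v → arc D v w) y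
                          (dominating-indeg ((λ e → w'≢w (sym e)) , x , into-x w opp-w , into-x w' opp-w'))
        u , u≢w , u→p = countF-avoid (λ v → arc D v p) w (dominating-indeg (p≢y , w , p→w , from-y w opp-w))
        opp-u : opposite x u ≡ true
        opp-u = trans (cong (inX x xor_) (path-same-side u→p p→w)) opp-w
    in  fourCycle D (from-y u opp-u) u→p p→w w→y (λ e → p≢y (sym e)) u≢w
    where
    into-x : ∀ v → opposite x v ≡ true → v ⟶ x within D
    into-x v opp = ∧-conicalʳ _ _ (full v opp)
    from-y : ∀ v → opposite x v ≡ true → y ⟶ v within D
    from-y v opp = ∧-conicalˡ _ _ (full v opp)

  -- Every dominating pair {x, y} lies on a 4-cycle: either 2-paths exist in
  -- both directions with distinct middles, x → w → y → u → x, or all of the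
  -- at least a 2-paths run one way and the saturated case applies.
  dominating-fourCycle : ∀ {x y} → Dominating D x y → Cycle D 4
  dominating-fourCycle {x} {y} d with countF (via x y) in #forth | countF (via y x) in #back
  ... | zero  | _     = saturated-fourCycle d (via-saturated
    (≤-trans (via-count d) (≤-reflexive (trans (cong (countF (via y x) +_) #forth) (+-identityʳ _)))))
  ... | suc _ | zero  = saturated-fourCycle (dominating-sym d) (via-saturated
    (≤-trans (via-count d) (≤-reflexive (cong (_+ countF (via x y)) #back))))
  ... | suc _ | suc _ =
    let u , w , u≢w , y→u→x , x→w→y = countF-distinct-witnesses (via y x) (via x y)
          (subst (1 ≤_) (sym #back) (s≤s z≤n)) (subst (1 ≤_) (sym #forth) (s≤s z≤n))
          (≤-trans (≤-trans (n≤1+n 3) a≥4) (via-count d))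
    in  fourCycle D (∧-conicalˡ _ _ x→w→y) (∧-conicalʳ _ _ x→w→y)
                    (∧-conicalˡ _ _ y→u→x) (∧-conicalʳ _ _ y→u→x)
                    (proj₁ d) (λ e → u≢w (sym e))

-- Lemma 4.2.  If D has a dominating pair, that pair lies on a 4-cycle, which
-- misses a vertex since D has 2a ≥ 8 vertices.  Otherwise in-neighbours are
-- unique and the strongly connected D is itself a cycle, which is excluded.
-- (Matching 4 ≤ a against s≤s exposes a as a successor, as the cycle lemma
-- is stated for vertex sets Fin (suc m).)
lemma4p2 : (a k : ℕ) → 4 ≤ a → 2 ≤ k → 2 * k ≤ a →
    (D : Digraph (a + a)) → BalancedBipartite a D → StronglyConnected D →
    ConditionB a k D → ¬ IsCycle D →
    Σ ℕ λ m → 4 ≤ m × Σ (Cycle D m) λ C →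
      ∃ λ (v : Fin (a + a)) → ∀ i → Cycle.vert C i ≢ v
lemma4p2 a k a≥4@(s≤s _) k≥2 2k≤a D bb strong cond notCycle with dominatingPairOrUniqueIn D
... | inj₁ (_ , _ , dominating) = 4 , ≤-refl , C , missedPoint 4<2a (Cycle.vert C)
  where
  C : Cycle D 4
  C = BipartiteBk.dominating-fourCycle a k k≥2 2k≤a D bb cond dominating
  4<2a : 4 < a + a
  4<2a = +-mono-≤ a≥4 (≤-trans (s≤s z≤n) a≥4)
... | inj₂ uniqueIn = ⊥-elim (notCycle (FunctionalDigraph.isCycle D 2≤2a strong uniqueIn))
  where
  2≤2a : 2 ≤ a + a
  2≤2a = ≤-trans (s≤s (s≤s z≤n)) (≤-trans a≥4 (m≤m+n a a))
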